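{- Let $G$ be a finite simple $4$-regular claw-free graph which does not contain $C_4$ as a subgraph. Then every edge of $G$ is uniquely triangulated.
   Context: A graph is claw-free if it does not contain $K_{1,3}$ as an induced subgraph. An edge is triangulated if it is contained in a triangle (a cycle of length three), and uniquely triangulated if it is contained in exactly one triangle. -}

module Defs where

open import Data.Nat using (ℕ)
open import Data.Bool using (Bool; true; false)
open import Data.Fin using (Fin)
open import Data.List using (List; length; filterᵇ)
open import Data.List using () renaming (allFin to allFinL)
open import Data.Product using (_×_; ∃-syntax)
open import Relation.Binary.PropositionalEquality using (_≡_; _≢_)
open import Relation.Nullary using (¬_)

record Graph (n : ℕ) : Set where
  field
    adj     : Fin n → Fin n → Bool
    irrefl  : ∀ v → adj v v ≡ false
    sym     : ∀ u v → adj u v ≡ adj v u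

open Graph public

Adj : ∀ {n} → Graph n → Fin n → Fin n → Set
Adj G u v = adj G u v ≡ true

neighbours : ∀ {n} → Graph n → Fin n → List (Fin n)
neighbours {n} G v = filterᵇ (adj G v) (allFinL n)

degree : ∀ {n} → Graph n → Fin n → ℕ
degree G v = length (neighbours G v)

Regular : ∀ {n} → ℕ → Graph n → Set
Regular k G = ∀ v → degree G v ≡ k

-- Induced K_{1,3}: centre c, three distinct leaves adjacent to c, pairwise non-adjacent.
-- (Leaves are automatically distinct from c by irreflexivity.)
InducedClaw : ∀ {n} → Graph n → Set
InducedClaw {n} G = ∃[ c ] ∃[ x ] ∃[ y ] ∃[ z ]
  ( x ≢ y × x ≢ z × y ≢ z
  × Adj G c x × Adj G c y × Adj G c z
  × ¬ Adj G x y × ¬ Adj G x z × ¬ Adj G y z )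

ClawFree : ∀ {n} → Graph n → Set
ClawFree G = ¬ InducedClaw G

ContainsC4 : ∀ {n} → Graph n → Set
ContainsC4 {n} G = ∃[ a ] ∃[ b ] ∃[ c ] ∃[ d ]
  ( a ≢ b × a ≢ c × a ≢ d × b ≢ c × b ≢ d × c ≢ d
  × Adj G a b × Adj G b c × Adj G c d × Adj G d a )

-- Triangles containing the edge uv correspond bijectively to common neighbours w of u and v.
commonNeighbours : ∀ {n} → Graph n → Fin n → Fin n → List (Fin n)
commonNeighbours {n} G u v = filterᵇ (λ w → Data.Bool._∧_ (adj G u w) (adj G v w)) (allFinL n)

trianglesOn : ∀ {n} → Graph n → Fin n → Fin n → ℕ
trianglesOn G u v = length (commonNeighbours G u v)

UniquelyTriangulated : ∀ {n} → Graph n → Fin n → Fin n → Set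
UniquelyTriangulated G u v = trianglesOn G u v ≡ 1

module Submission where

-- The triangles on an edge uv correspond to the common neighbours of u and v,
-- so we show that the (duplicate-free) list of common neighbours has exactly
-- one element:
--
--  * at most one: two distinct common neighbours x, y give the 4-cycle
--    u-x-v-y (lemma twoCommonNeighbours⇒C4);
--  * at least one: if uv lies in no triangle, pick three neighbours a, b, c
--    of u other than v (u has degree 4).  None of them is adjacent to v, so
--    claw-freeness at u applied to the leaves v,a,b and v,b,c forces the
--    edges ab and bc, and u-a-b-c is a 4-cycle (triangleFreeEdge⇒C4).

open import Defs
open import Data.Nat using (ℕ; _≤_; s≤s)
open import Data.Nat.Properties using (≤-reflexive)
open import Data.Fin using (Fin; _≟_)
open import Data.Bool using (Bool; true; _∧_; T?) renaming (_≟_ to _≟ᵇ_)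
open import Data.Bool.Properties using (T-≡; ∧-conicalˡ; ∧-conicalʳ)
open import Data.Product using (_×_; _,_; ∃-syntax; proj₁; proj₂)
open import Data.List using (List; []; _∷_; length; filterᵇ; allFin)
open import Data.List.Membership.Propositional using (_∈_; _∉_)
open import Data.List.Membership.Propositional.Properties using (∈-filter⁺; ∈-filter⁻; ∈-allFin)
open import Data.List.Relation.Unary.Unique.Propositional using (Unique)
open import Data.List.Relation.Unary.Unique.Propositional.Properties using (filter⁺; allFin⁺)
open import Data.List.Relation.Unary.AllPairs using (_∷_)
open import Data.List.Relation.Unary.All using (_∷_)
open import Data.List.Relation.Unary.Any using (here; there)
open import Data.Sum using (_⊎_; inj₁; inj₂)
open import Function using (_∘_)
open import Function.Bundles using (Equivalence)
open import Relation.Binary.Definitions using (DecidableEquality)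
open import Relation.Binary.PropositionalEquality
  using (_≡_; _≢_; ≢-sym; refl; cong₂; trans) renaming (sym to ≡-sym)
open import Relation.Nullary using (¬_; yes; no; contradiction)

module _ {A : Set} where

  pattern at₀ = here refl
  pattern at₁ = there (here refl)
  pattern at₂ = there (there (here refl))
  pattern at₃ = there (there (there (here refl)))

  length≡1 : {xs : List A} → Unique xs → (∃[ w ] w ∈ xs) →
    (∀ {x y} → x ∈ xs → y ∈ xs → x ≡ y) → length xs ≡ 1
  length≡1 {[]}        _               (_ , ()) _
  length≡1 {_ ∷ []}    _               _        _    = refl
  length≡1 {_ ∷ _ ∷ _} ((x≢y ∷ _) ∷ _) _        same =
    contradiction (same at₀ at₁) x≢y

  memberOrEmpty : (xs : List A) → (∃[ w ] w ∈ xs) ⊎ (∀ {w} → w ∉ xs)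
  memberOrEmpty []      = inj₂ (λ ())
  memberOrEmpty (x ∷ _) = inj₁ (x , at₀)

  record ThreeOthers (xs : List A) (v : A) : Set where
    constructor threeOthersOf
    field
      a b c : A
      a≢b   : a ≢ b
      a≢c   : a ≢ c
      b≢c   : b ≢ c
      v≢a   : v ≢ a
      v≢b   : v ≢ b
      v≢c   : v ≢ c
      a∈    : a ∈ xs
      b∈    : b ∈ xs
      c∈    : c ∈ xs

  threeOthers : DecidableEquality A → {xs : List A} → Unique xs → 4 ≤ length xs →
    (v : A) → ThreeOthers xs v
  threeOthers _≟ₐ_ {a ∷ b ∷ c ∷ d ∷ _}
      ((a≢b ∷ a≢c ∷ a≢d ∷ _) ∷ (b≢c ∷ b≢d ∷ _) ∷ (c≢d ∷ _) ∷ _) (s≤s (s≤s (s≤s (s≤s _)))) v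
    with v ≟ₐ a | v ≟ₐ b | v ≟ₐ c
  ... | yes refl | _ | _ =
    threeOthersOf b c d b≢c b≢d c≢d a≢b a≢c a≢d at₁ at₂ at₃
  ... | no _ | yes refl | _ =
    threeOthersOf a c d a≢c a≢d c≢d (≢-sym a≢b) b≢c b≢d at₀ at₂ at₃
  ... | no _ | no _ | yes refl =
    threeOthersOf a b d a≢b a≢d b≢d (≢-sym a≢c) (≢-sym b≢c) c≢d at₀ at₁ at₃
  ... | no v≢a | no v≢b | no v≢c =
    threeOthersOf a b c a≢b a≢c b≢c v≢a v≢b v≢c at₀ at₁ at₂

module _ {n : ℕ} (f : Fin n → Bool) where

  selected⁺ : ∀ {w} → f w ≡ true → w ∈ filterᵇ f (allFin n)
  selected⁺ {w} fw = ∈-filter⁺ (T? ∘ f) (∈-allFin w) (Equivalence.from T-≡ fw)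

  selected⁻ : ∀ {w} → w ∈ filterᵇ f (allFin n) → f w ≡ true
  selected⁻ w∈ = Equivalence.to T-≡ (proj₂ (∈-filter⁻ (T? ∘ f) {xs = allFin n} w∈))

  selected-unique : Unique (filterᵇ f (allFin n))
  selected-unique = filter⁺ (T? ∘ f) (allFin⁺ n)

module _ {n : ℕ} (G : Graph n) where

  adj⇒≢ : ∀ {u w} → Adj G u w → u ≢ w
  adj⇒≢ {u} uw refl with trans (≡-sym uw) (irrefl G u)
  ... | ()

  adj-sym : ∀ {u w} → Adj G u w → Adj G w u
  adj-sym {u} {w} uw = trans (Graph.sym G w u) uw

  ∈-neighbours⁻ : ∀ {u w} → w ∈ neighbours G u → Adj G u w
  ∈-neighbours⁻ {u} = selected⁻ (adj G u)

  ∈-commonNeighbours⁺ : ∀ {u v w} → Adj G u w → Adj G v w → w ∈ commonNeighbours G u v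
  ∈-commonNeighbours⁺ {u} {v} uw vw = selected⁺ (λ x → adj G u x ∧ adj G v x) (cong₂ _∧_ uw vw)

  ∈-commonNeighbours⁻ : ∀ {u v w} → w ∈ commonNeighbours G u v → Adj G u w × Adj G v w
  ∈-commonNeighbours⁻ {u} {v} {w} w∈ =
    ∧-conicalˡ (adj G u w) (adj G v w) both , ∧-conicalʳ (adj G u w) (adj G v w) both
    where
    both : adj G u w ∧ adj G v w ≡ true
    both = selected⁻ (λ x → adj G u x ∧ adj G v x) w∈

  clawFree⇒adj : ClawFree G → ∀ {c x y z} → Adj G c x → Adj G c y → Adj G c z →
    x ≢ y → x ≢ z → y ≢ z → ¬ Adj G x y → ¬ Adj G x z → Adj G y z
  clawFree⇒adj cf {c} {x} {y} {z} cx cy cz x≢y x≢z y≢z ¬xy ¬xz with adj G y z ≟ᵇ true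
  ... | yes yz = yz
  ... | no ¬yz = contradiction (c , x , y , z , x≢y , x≢z , y≢z , cx , cy , cz , ¬xy , ¬xz , ¬yz) cf

  twoCommonNeighbours⇒C4 : ∀ {u v x y} → u ≢ v → x ≢ y →
    Adj G u x → Adj G v x → Adj G u y → Adj G v y → ContainsC4 G
  twoCommonNeighbours⇒C4 {u} {v} {x} {y} u≢v x≢y ux vx uy vy =
    u , x , v , y , adj⇒≢ ux , u≢v , adj⇒≢ uy , ≢-sym (adj⇒≢ vx) , x≢y , adj⇒≢ vy ,
    ux , adj-sym vx , vy , adj-sym uy

  commonNeighbours-atMostOne : ¬ ContainsC4 G → ∀ {u v x y} → u ≢ v →
    x ∈ commonNeighbours G u v → y ∈ commonNeighbours G u v → x ≡ y
  commonNeighbours-atMostOne noC4 {u} {v} {x} {y} u≢v x∈ y∈ with x ≟ y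
  ... | yes x≡y = x≡y
  ... | no x≢y  = contradiction (twoCommonNeighbours⇒C4 u≢v x≢y ux vx uy vy) noC4
    where
    ux : Adj G u x
    ux = proj₁ (∈-commonNeighbours⁻ x∈)
    vx : Adj G v x
    vx = proj₂ (∈-commonNeighbours⁻ x∈)
    uy : Adj G u y
    uy = proj₁ (∈-commonNeighbours⁻ y∈)
    vy : Adj G v y
    vy = proj₂ (∈-commonNeighbours⁻ y∈)

  triangleFreeEdge⇒C4 : ClawFree G → ∀ {u v} → Adj G u v →
    (∀ w → Adj G u w → ¬ Adj G v w) → ThreeOthers (neighbours G u) v → ContainsC4 G
  triangleFreeEdge⇒C4 cf {u} {v} uv noTriangle
      (threeOthersOf a b c a≢b a≢c b≢c v≢a v≢b v≢c a∈ b∈ c∈) =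
    u , a , b , c , adj⇒≢ ua , adj⇒≢ ub , adj⇒≢ uc , a≢b , a≢c , b≢c ,
    ua , ab , bc , adj-sym uc
    where
    ua : Adj G u a
    ua = ∈-neighbours⁻ a∈
    ub : Adj G u b
    ub = ∈-neighbours⁻ b∈
    uc : Adj G u c
    uc = ∈-neighbours⁻ c∈
    ab : Adj G a b
    ab = clawFree⇒adj cf uv ua ub v≢a v≢b a≢b (noTriangle a ua) (noTriangle b ub)
    bc : Adj G b c
    bc = clawFree⇒adj cf uv ub uc v≢b v≢c b≢c (noTriangle b ub) (noTriangle c uc)

  commonNeighbour-exists : ClawFree G → ¬ ContainsC4 G → ∀ {u v} → 4 ≤ degree G u →
    Adj G u v → ∃[ w ] w ∈ commonNeighbours G u v
  commonNeighbour-exists cf noC4 {u} {v} deg uv with memberOrEmpty (commonNeighbours G u v)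
  ... | inj₁ common = common
  ... | inj₂ none   = contradiction (triangleFreeEdge⇒C4 cf uv noTriangle others) noC4
    where
    noTriangle : ∀ w → Adj G u w → ¬ Adj G v w
    noTriangle w uw vw = none (∈-commonNeighbours⁺ uw vw)
    others : ThreeOthers (neighbours G u) v
    others = threeOthers _≟_ (selected-unique (adj G u)) deg v

proposition3 : (n : ℕ) (G : Graph n) → Regular 4 G → ClawFree G → ¬ ContainsC4 G →
    (u v : Fin n) → Adj G u v → UniquelyTriangulated G u v
proposition3 n G regular clawFree noC4 u v uv =
  length≡1 (selected-unique (λ w → adj G u w ∧ adj G v w))
    (commonNeighbour-exists G clawFree noC4 (≤-reflexive (≡-sym (regular u))) uv)
    (commonNeighbours-atMostOne G noC4 (adj⇒≢ G uv))
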